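{- Every binding polynomial functor on $\mathsf{Nom}$ has a canonical locally monotone extension to the Kleisli category $\mathsf{Kl}(\mathcal{P}_{\mathsf{ufs}})$.
   Context: Fix a countably infinite set $\mathbb{A}$ of names; nominal sets are sets with an action of the finite permutations of $\mathbb{A}$ in which every element has a finite support; $\mathsf{Nom}$ is the category of nominal sets and equivariant maps. $\mathcal{P}_{\mathsf{ufs}}X$ is the nominal set of uniformly finitely supported subsets of $X$ ($S$ with $\bigcup_{x\in S}\mathrm{supp}(x)$ finite), a monad with unit $x\mapsto\{x\}$, multiplication union. The abstraction functor $[\mathbb{A}](-)$ sends $X$ to the quotient of $\mathbb{A}\times X$ by $(a,x)\sim(b,y)$ iff $(a\,c)\cdot x=(b\,c)\cdot y$ for some fresh $c$. The binding polynomial functors are the smallest class of endofunctors on $\mathsf{Nom}$ containing all constant functors, the identity and the abstraction functor, and closed under finite products and arbitrary coproducts. $\mathsf{Kl}(\mathcal{P}_{\mathsf{ufs}})$ is the Kleisli category (morphisms $X\to Y$ are equivariant maps $X\to\mathcal{P}_{\mathsf{ufs}}Y$), with hom-sets ordered pointwise by inclusion; an extension of $F$ is an endofunctor $\bar F$ on $\mathsf{Kl}(\mathcal{P}_{\mathsf{ufs}})$ with $\bar FJ=JF$ where $J(f)(x)=\{f(x)\}$, and it is locally monotone if it is monotone on hom-sets. The canonical extension is built along the structure of the functor: constants and identity extend trivially, the abstraction functor via $\langle a\rangle S\mapsto\{\langle a\rangle s:s\in S\}$, coproducts componentwise, and finite products using the canonical strength $(x,S)\mapsto\{(x,s):s\in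 S\}$ of $\mathcal{P}_{\mathsf{ufs}}$. -}

module Defs where

open import Data.Nat using (ℕ; _≡ᵇ_)
open import Data.Bool using (if_then_else_)
open import Data.Product using (Σ; ∃; _×_; _,_; proj₁; proj₂)
open import Data.List using (List; []; _∷_; _++_)
open import Data.List.Membership.Propositional using (_∈_; _∉_)
open import Relation.Binary.PropositionalEquality using (_≡_; _≢_)
open import Relation.Binary.Structures using (IsEquivalence)
open import Function using (_∘_)

𝔸 : Set
𝔸 = ℕ

swapName : 𝔸 → 𝔸 → 𝔸 → 𝔸
swapName a b c = if c ≡ᵇ a then b else (if c ≡ᵇ b then a else c)

-- Finite permutations, presented as words of transpositions.
-- ⟦ (a , b) ∷ π ⟧ = (a b) ∘ ⟦ π ⟧ .
Perm : Set
Perm = List (𝔸 × 𝔸)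

⟦_⟧ : Perm → 𝔸 → 𝔸
⟦ [] ⟧ c = c
⟦ (a , b) ∷ π ⟧ c = swapName a b (⟦ π ⟧ c)

record PreNom : Set₁ where
  field
    Carrier : Set
    _≈_     : Carrier → Carrier → Set
    act     : Perm → Carrier → Carrier

open PreNom public

Supports : (X : PreNom) → List 𝔸 → Carrier X → Set
Supports X A x = ∀ (π : Perm) → (∀ a → a ∈ A → ⟦ π ⟧ a ≡ a) → _≈_ X (act X π x) x

Fresh : (X : PreNom) → 𝔸 → Carrier X → Set
Fresh X c x = ∃ λ A → Supports X A x × c ∉ A

record IsNominal (X : PreNom) : Set where
  field
    isEquivalence : IsEquivalence (_≈_ X)
    act-cong  : ∀ π {x y} → _≈_ X x y → _≈_ X (act X π x) (act X π y)
    act-id    : ∀ x → _≈_ X (act X [] x) x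
    act-comp  : ∀ π σ x → _≈_ X (act X (π ++ σ) x) (act X π (act X σ x))
    act-ext   : ∀ π σ → (∀ c → ⟦ π ⟧ c ≡ ⟦ σ ⟧ c) → ∀ x → _≈_ X (act X π x) (act X σ x)
    finSupp   : ∀ x → ∃ λ A → Supports X A x

record NomSet : Set₁ where
  field
    pre   : PreNom
    isNom : IsNominal pre

open NomSet public

record IsEquivariant (X Y : PreNom) (f : Carrier X → Carrier Y) : Set where
  field
    f-cong  : ∀ {x x'} → _≈_ X x x' → _≈_ Y (f x) (f x')
    f-equiv : ∀ π x → _≈_ Y (f (act X π x)) (act Y π (f x))

_⊗ₚ_ : PreNom → PreNom → PreNom
X ⊗ₚ Y = record
  { Carrier = Carrier X × Carrier Y
  ; _≈_ = λ p q → _≈_ X (proj₁ p) (proj₁ q) × _≈_ Y (proj₂ p) (proj₂ q)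
  ; act = λ π p → act X π (proj₁ p) , act Y π (proj₂ p)
  }

data CoEq {I : Set} (Xs : I → PreNom) :
     Σ I (Carrier ∘ Xs) → Σ I (Carrier ∘ Xs) → Set where
  mk : ∀ {i x y} → _≈_ (Xs i) x y → CoEq Xs (i , x) (i , y)

∐ₚ : (I : Set) → (I → PreNom) → PreNom
∐ₚ I Xs = record
  { Carrier = Σ I (Carrier ∘ Xs)
  ; _≈_ = CoEq Xs
  ; act = λ π p → proj₁ p , act (Xs (proj₁ p)) π (proj₂ p)
  }

-- Name abstraction [𝔸]X : pairs (a , x) modulo
-- (a , x) ∼ (b , y) iff (a c)·x ≈ (b c)·y for some c fresh for a, x, b, y.
-- (The quotient is represented as a setoid.)
AbsEq : (X : PreNom) → 𝔸 × Carrier X → 𝔸 × Carrier X → Set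
AbsEq X (a , x) (b , y) =
  ∃ λ c → c ≢ a × c ≢ b × Fresh X c x × Fresh X c y
        × _≈_ X (act X ((a , c) ∷ []) x) (act X ((b , c) ∷ []) y)

[𝔸]ₚ : PreNom → PreNom
[𝔸]ₚ X = record
  { Carrier = 𝔸 × Carrier X
  ; _≈_ = AbsEq X
  ; act = λ π p → ⟦ π ⟧ (proj₁ p) , act X π (proj₂ p)
  }

data Poly : Set₁ where
  const : NomSet → Poly
  idF   : Poly
  absF  : Poly
  unitF : Poly
  _⊗_   : Poly → Poly → Poly
  ∐     : (I : Set) → (I → Poly) → Poly

UnitP : PreNom
UnitP = record { Carrier = Unit ; _≈_ = λ _ _ → Unit ; act = λ _ u → u }
  where open import Data.Unit using () renaming (⊤ to Unit)

F : Poly → PreNom → PreNom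
F (const N) X = pre N
F idF       X = X
F absF      X = [𝔸]ₚ X
F unitF     X = UnitP
F (P ⊗ Q)   X = F P X ⊗ₚ F Q X
F (∐ I P)   X = ∐ₚ I (λ i → F (P i) X)

Fmap : (P : Poly) {X Y : PreNom} → (Carrier X → Carrier Y)
     → Carrier (F P X) → Carrier (F P Y)
Fmap (const N) f u       = u
Fmap idF       f x       = f x
Fmap absF      f (a , x) = a , f x
Fmap unitF     f u       = u
Fmap (P ⊗ Q)   f (u , v) = Fmap P f u , Fmap Q f v
Fmap (∐ I P)   f (i , u) = i , Fmap (P i) f u

-- The Kleisli category of P_ufs, with morphisms X → P_ufs Y presented
-- as relations  R x y  ⇔  y ∈ f(x).

KRel : PreNom → PreNom → Set₁
KRel X Y = Carrier X → Carrier Y → Set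

-- R is a morphism X → Y of Kl(P_ufs): R x is a ≈-closed subset of Y,
-- the map x ↦ R x is equivariant (and ≈-respecting), and every R x is
-- uniformly finitely supported (one finite set of names supports all
-- of its elements).
record IsKlMor (X Y : PreNom) (R : KRel X Y) : Set where
  field
    rel-cong  : ∀ {x x' y y'} → _≈_ X x x' → _≈_ Y y y' → R x y → R x' y'
    rel-equiv : ∀ π {x y} → R x y → R (act X π x) (act Y π y)
    rel-ufs   : ∀ x → ∃ λ A → ∀ y → R x y → Supports Y A y

idK : (X : PreNom) → KRel X X
idK X = _≈_ X

_⊙_ : {X Y Z : PreNom} → KRel Y Z → KRel X Y → KRel X Z
(S ⊙ R) x z = ∃ λ y → R x y × S y z

J : {X Y : PreNom} → (Carrier X → Carrier Y) → KRel X Y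
J {Y = Y} f x y = _≈_ Y (f x) y

_≐_ : {X Y : PreNom} → KRel X Y → KRel X Y → Set
R ≐ S = ∀ x y → (R x y → S x y) × (S x y → R x y)

_⊑_ : {X Y : PreNom} → KRel X Y → KRel X Y → Set
R ⊑ S = ∀ x y → R x y → S x y

data CoRel {I : Set} (Xs Ys : I → PreNom)
     (Rs : ∀ i → Carrier (Xs i) → Carrier (Ys i) → Set) :
     Σ I (Carrier ∘ Xs) → Σ I (Carrier ∘ Ys) → Set where
  mk : ∀ {i x y} → Rs i x y → CoRel Xs Ys Rs (i , x) (i , y)

Fbar : (P : Poly) {X Y : PreNom} → KRel X Y → KRel (F P X) (F P Y)
Fbar (const N) R u v = _≈_ (pre N) u v
Fbar idF       R x y = R x y
Fbar absF {Y = Y} R (a , x) t = ∃ λ y → R x y × AbsEq Y (a , y) t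
Fbar unitF     R u v = _≈_ UnitP u v
-- binary products: F̄P × F̄Q followed by the double strength
-- (S , T) ↦ { (s , t) : s ∈ S , t ∈ T } induced by the canonical strength
Fbar (P ⊗ Q)   R (u , v) (u' , v') = Fbar P R u u' × Fbar Q R v v'
Fbar (∐ I P) {X} {Y} R =
  CoRel (λ i → F (P i) X) (λ i → F (P i) Y) (λ i → Fbar (P i) R)

record IsLocallyMonotoneExtension (P : Poly) : Set₁ where
  field
    mor   : (X Y : NomSet) (R : KRel (pre X) (pre Y)) →
            IsKlMor (pre X) (pre Y) R →
            IsKlMor (F P (pre X)) (F P (pre Y)) (Fbar P {pre X} {pre Y} R)
    resp-id : (X : NomSet) →
              _≐_ {F P (pre X)} {F P (pre X)} (Fbar P (idK (pre X))) (idK (F P (pre X)))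
    resp-∘  : (X Y Z : NomSet) (R : KRel (pre X) (pre Y)) (S : KRel (pre Y) (pre Z)) →
              IsKlMor (pre X) (pre Y) R → IsKlMor (pre Y) (pre Z) S →
              _≐_ {F P (pre X)} {F P (pre Z)}
                (Fbar P {pre X} {pre Z} (_⊙_ {pre X} {pre Y} {pre Z} S R))
                (_⊙_ {F P (pre X)} {F P (pre Y)} {F P (pre Z)}
                   (Fbar P {pre Y} {pre Z} S) (Fbar P {pre X} {pre Y} R))
    extends : (X Y : NomSet) (f : Carrier (pre X) → Carrier (pre Y)) →
              IsEquivariant (pre X) (pre Y) f →
              _≐_ {F P (pre X)} {F P (pre Y)}
                (Fbar P {pre X} {pre Y} (J {pre X} {pre Y} f))
                (J {F P (pre X)} {F P (pre Y)} (Fmap P {pre X} {pre Y} f))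
    monotone : (X Y : NomSet) (R S : KRel (pre X) (pre Y)) →
               IsKlMor (pre X) (pre Y) R → IsKlMor (pre X) (pre Y) S →
               _⊑_ {pre X} {pre Y} R S →
               _⊑_ {F P (pre X)} {F P (pre Y)} (Fbar P {pre X} {pre Y} R) (Fbar P {pre X} {pre Y} S)

-- The canonical extension is defined by recursion on the code, so every
-- property is proved by induction on the code, and all cases but abstraction
-- are immediate. For abstraction, F̄R relates ⟨a⟩x to the ⟨a⟩y with y ∈ R x,
-- and the point is that this is well defined on α-classes: if
-- ⟨a⟩x = ⟨a'⟩x' then every ⟨a⟩y with y ∈ R x equals some ⟨a'⟩y' with
-- y' ∈ R x'. This rests on two facts: α-equivalence does not depend on the
-- choice of fresh name, and, because R x is uniformly finitely supported,
-- R creates no names (a name fresh for x is fresh for every y ∈ R x).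
module Submission where

open import Defs
open import Data.Nat using (zero; suc; _≡ᵇ_)
open import Data.Nat.Properties using (_≟_; <-irrefl; ≤-totalOrder)
open import Data.List.Extrema ≤-totalOrder using (max; xs≤max)
open import Data.Bool using (true; false)
open import Data.Empty using (⊥-elim)
open import Data.Product using (∃; _×_; _,_; proj₁; proj₂)
open import Data.List using (List; []; _∷_; _++_; map)
open import Data.List.Membership.Propositional using (_∈_; _∉_)
open import Data.List.Membership.Propositional.Properties using (∈-++⁺ˡ; ∈-++⁺ʳ; ∈-map⁺; ∈-map⁻)
open import Data.List.Relation.Unary.All using (lookup)
open import Data.List.Relation.Unary.Any using (here; there)
open import Data.Unit using (tt)
open import Function using (_∘_)
open import Relation.Binary.PropositionalEquality
  using (_≡_; _≢_; refl; sym; trans; cong; cong₂; subst; ≢-sym)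
open import Relation.Binary.Structures using (IsEquivalence)
open import Relation.Nullary using (yes; no)

≡ᵇ-refl : ∀ n → (n ≡ᵇ n) ≡ true
≡ᵇ-refl zero    = refl
≡ᵇ-refl (suc n) = ≡ᵇ-refl n

≢⇒≡ᵇ≡false : ∀ m n → m ≢ n → (m ≡ᵇ n) ≡ false
≢⇒≡ᵇ≡false zero    zero    m≢n = ⊥-elim (m≢n refl)
≢⇒≡ᵇ≡false zero    (suc n) _   = refl
≢⇒≡ᵇ≡false (suc m) zero    _   = refl
≢⇒≡ᵇ≡false (suc m) (suc n) m≢n = ≢⇒≡ᵇ≡false m n (m≢n ∘ cong suc)

swapName-left : ∀ a b → swapName a b a ≡ b
swapName-left a b rewrite ≡ᵇ-refl a = refl

swapName-right : ∀ a b → swapName a b b ≡ a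
swapName-right a b with b ≟ a
... | yes refl rewrite ≡ᵇ-refl b = refl
... | no b≢a rewrite ≢⇒≡ᵇ≡false b a b≢a | ≡ᵇ-refl b = refl

swapName-other : ∀ {a b c} → c ≢ a → c ≢ b → swapName a b c ≡ c
swapName-other {a} {b} {c} c≢a c≢b rewrite ≢⇒≡ᵇ≡false c a c≢a | ≢⇒≡ᵇ≡false c b c≢b = refl

swapName-involutive : ∀ a b c → swapName a b (swapName a b c) ≡ c
swapName-involutive a b c with c ≟ a | c ≟ b
... | yes refl | _        = trans (cong (swapName c b) (swapName-left c b)) (swapName-right c b)
... | no _     | yes refl = trans (cong (swapName a c) (swapName-right a c)) (swapName-left a c)
... | no c≢a   | no c≢b   =
  trans (cong (swapName a b) (swapName-other c≢a c≢b)) (swapName-other c≢a c≢b)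

swapName-injective : ∀ a b {m n} → swapName a b m ≡ swapName a b n → m ≡ n
swapName-injective a b {m} {n} e =
  trans (sym (swapName-involutive a b m))
        (trans (cong (swapName a b) e) (swapName-involutive a b n))

swapName-conjugate : (f : 𝔸 → 𝔸) → (∀ {m n} → f m ≡ f n → m ≡ n) → ∀ a c n →
                     f (swapName a c n) ≡ swapName (f a) (f c) (f n)
swapName-conjugate f f-inj a c n with n ≟ a | n ≟ c
... | yes refl | _        = trans (cong f (swapName-left n c)) (sym (swapName-left (f n) (f c)))
... | no _     | yes refl = trans (cong f (swapName-right a n)) (sym (swapName-right (f a) (f n)))
... | no n≢a   | no n≢c   =
  trans (cong f (swapName-other n≢a n≢c))
        (sym (swapName-other (n≢a ∘ f-inj) (n≢c ∘ f-inj)))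

swap : 𝔸 → 𝔸 → Perm
swap a b = (a , b) ∷ []

⟦⟧-++ : ∀ π σ n → ⟦ π ++ σ ⟧ n ≡ ⟦ π ⟧ (⟦ σ ⟧ n)
⟦⟧-++ []            σ n = refl
⟦⟧-++ ((a , b) ∷ π) σ n = cong (swapName a b) (⟦⟧-++ π σ n)

-- Every transposition is its own inverse, so reversing the word inverts it.
invPerm : Perm → Perm
invPerm []      = []
invPerm (t ∷ π) = invPerm π ++ (t ∷ [])

⟦invPerm⟧-inverseˡ : ∀ π n → ⟦ invPerm π ⟧ (⟦ π ⟧ n) ≡ n
⟦invPerm⟧-inverseˡ []            n = refl
⟦invPerm⟧-inverseˡ ((a , b) ∷ π) n =
  trans (⟦⟧-++ (invPerm π) (swap a b) _)
        (trans (cong ⟦ invPerm π ⟧ (swapName-involutive a b _)) (⟦invPerm⟧-inverseˡ π n))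

⟦invPerm⟧-inverseʳ : ∀ π n → ⟦ π ⟧ (⟦ invPerm π ⟧ n) ≡ n
⟦invPerm⟧-inverseʳ []            n = refl
⟦invPerm⟧-inverseʳ ((a , b) ∷ π) n =
  trans (cong (swapName a b ∘ ⟦ π ⟧) (⟦⟧-++ (invPerm π) (swap a b) n))
        (trans (cong (swapName a b) (⟦invPerm⟧-inverseʳ π _)) (swapName-involutive a b n))

⟦⟧-injective : ∀ π {m n} → ⟦ π ⟧ m ≡ ⟦ π ⟧ n → m ≡ n
⟦⟧-injective π {m} {n} e =
  trans (sym (⟦invPerm⟧-inverseˡ π m))
        (trans (cong ⟦ invPerm π ⟧ e) (⟦invPerm⟧-inverseˡ π n))

fresh : (L : List 𝔸) → ∃ λ d → d ∉ L
fresh L = suc (max 0 L) , λ d∈L → <-irrefl refl (lookup (xs≤max 0 L) d∈L)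

∈∧∉⇒≢ : ∀ {n d : 𝔸} {L} → n ∈ L → d ∉ L → n ≢ d
∈∧∉⇒≢ n∈L d∉L refl = d∉L n∈L

module Nominal (X : NomSet) where
  private
    P = pre X
  open IsNominal (isNom X) public
  module ≈ = IsEquivalence isEquivalence

  act-invPerm : ∀ π x → _≈_ P (act P (invPerm π) (act P π x)) x
  act-invPerm π x =
    ≈.trans (≈.sym (act-comp (invPerm π) π x))
      (≈.trans (act-ext (invPerm π ++ π) []
                  (λ c → trans (⟦⟧-++ (invPerm π) π c) (⟦invPerm⟧-inverseˡ π c)) x)
               (act-id x))

  act-swap-involutive : ∀ a b x → _≈_ P (act P (swap a b) (act P (swap a b) x)) x
  act-swap-involutive a b = act-invPerm (swap a b)

  Supports-resp-≈ : ∀ {A x y} → Supports P A x → _≈_ P x y → Supports P A y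
  Supports-resp-≈ s x≈y π fix = ≈.trans (act-cong π (≈.sym x≈y)) (≈.trans (s π fix) x≈y)

  -- π·x is supported by π·A, since π·x is fixed by σ exactly when x is fixed by π⁻¹σπ.
  Supports-act : ∀ {A x} → Supports P A x → ∀ π → Supports P (map ⟦ π ⟧ A) (act P π x)
  Supports-act {A} {x} s π σ fix =
    ≈.trans (≈.sym (act-comp σ π x))
      (≈.trans (≈.sym (act-ext (π ++ τ) (σ ++ π) πτ≡σπ x))
        (≈.trans (act-comp π τ x) (act-cong π (s τ τ-fixes-A))))
    where
      τ = invPerm π ++ (σ ++ π)
      τ-fixes-A : ∀ a → a ∈ A → ⟦ τ ⟧ a ≡ a
      τ-fixes-A a a∈A =
        trans (⟦⟧-++ (invPerm π) (σ ++ π) a)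
          (trans (cong ⟦ invPerm π ⟧ (trans (⟦⟧-++ σ π a) (fix (⟦ π ⟧ a) (∈-map⁺ ⟦ π ⟧ a∈A))))
                 (⟦invPerm⟧-inverseˡ π a))
      πτ≡σπ : ∀ c → ⟦ π ++ τ ⟧ c ≡ ⟦ σ ++ π ⟧ c
      πτ≡σπ c = trans (⟦⟧-++ π τ c)
                  (trans (cong ⟦ π ⟧ (⟦⟧-++ (invPerm π) (σ ++ π) c)) (⟦invPerm⟧-inverseʳ π _))

  Fresh-act : ∀ {m x} → Fresh P m x → ∀ π → Fresh P (⟦ π ⟧ m) (act P π x)
  Fresh-act {m} (A , s , m∉A) π = map ⟦ π ⟧ A , Supports-act s π , πm∉πA
    where
      πm∉πA : ⟦ π ⟧ m ∉ map ⟦ π ⟧ A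
      πm∉πA πm∈πA with ∈-map⁻ ⟦ π ⟧ πm∈πA
      ... | a , a∈A , πm≡πa = m∉A (subst (_∈ A) (sym (⟦⟧-injective π πm≡πa)) a∈A)

  Fresh-swap : ∀ {m n x} a b → Fresh P m x → swapName a b m ≡ n → Fresh P n (act P (swap a b) x)
  Fresh-swap a b m#x refl = Fresh-act m#x (swap a b)

  Fresh-resp-≈ : ∀ {m x y} → Fresh P m x → _≈_ P x y → Fresh P m y
  Fresh-resp-≈ (A , s , m∉A) x≈y = A , Supports-resp-≈ s x≈y , m∉A

  AbsEq-cong : ∀ {a x x'} → _≈_ P x x' → AbsEq P (a , x) (a , x')
  AbsEq-cong {a} {x} x≈x' =
    let (A , s) = finSupp x
        (c , c∉) = fresh (a ∷ A)
    in c , c∉ ∘ here , c∉ ∘ here , (A , s , c∉ ∘ there) ,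
       (A , Supports-resp-≈ s x≈x' , c∉ ∘ there) , act-cong (swap a c) x≈x'

  AbsEq-refl : ∀ t → AbsEq P t t
  AbsEq-refl (a , x) = AbsEq-cong ≈.refl

  AbsEq-sym : ∀ {t u} → AbsEq P t u → AbsEq P u t
  AbsEq-sym (c , c≢a , c≢b , c#x , c#y , eq) = c , c≢b , c≢a , c#y , c#x , ≈.sym eq

  IsAbsWitness : 𝔸 → 𝔸 × Carrier P → 𝔸 × Carrier P → Set
  IsAbsWitness c (a , x) (b , y) =
    c ≢ a × c ≢ b × Fresh P c x × Fresh P c y
      × _≈_ P (act P (swap a c) x) (act P (swap b c) y)

  avoided : ∀ {t u} → AbsEq P t u → List 𝔸
  avoided {a , _} {b , _} (c , _ , _ , (Cx , _) , (Cy , _) , _) = a ∷ b ∷ c ∷ Cx ++ Cy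

  private
    swap-rename : ∀ {a c d x C} → Supports P C x → c ∉ C → d ∉ C → c ≢ a → d ≢ a → d ≢ c →
                  _≈_ P (act P (swap c d) (act P (swap a c) x)) (act P (swap a d) x)
    swap-rename {a} {c} {d} {x} {C} s c∉C d∉C c≢a d≢a d≢c =
      ≈.trans (≈.sym (act-comp (swap c d) (swap a c) x))
        (≈.trans (act-ext (swap c d ++ swap a c) (swap a d ++ swap c d) pointwise x)
          (≈.trans (act-comp (swap a d) (swap c d) x)
                   (act-cong (swap a d) (s (swap c d) cd-fixes-C))))
      where
        pointwise : ∀ n → swapName c d (swapName a c n) ≡ swapName a d (swapName c d n)
        pointwise n =
          trans (swapName-conjugate (swapName c d) (swapName-injective c d) a c n)
                (cong₂ (λ u v → swapName u v (swapName c d n))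
                       (swapName-other (≢-sym c≢a) (≢-sym d≢a)) (swapName-left c d))
        cd-fixes-C : ∀ n → n ∈ C → swapName c d n ≡ n
        cd-fixes-C n n∈C = swapName-other (∈∧∉⇒≢ n∈C c∉C) (∈∧∉⇒≢ n∈C d∉C)

  AbsEq-anyWitness : ∀ {t u d} (h : AbsEq P t u) → d ∉ avoided h → IsAbsWitness d t u
  AbsEq-anyWitness (c , c≢a , c≢b , (Cx , sx , c∉Cx) , (Cy , sy , c∉Cy) , eq) d∉ =
    d≢a , d≢b , (Cx , sx , d∉Cx) , (Cy , sy , d∉Cy) ,
    ≈.trans (≈.sym (swap-rename sx c∉Cx d∉Cx c≢a d≢a d≢c))
            (≈.trans (act-cong _ eq) (swap-rename sy c∉Cy d∉Cy c≢b d≢b d≢c))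
    where
      d≢a = d∉ ∘ here
      d≢b = d∉ ∘ there ∘ here
      d≢c = d∉ ∘ there ∘ there ∘ here
      d∉Cx = d∉ ∘ there ∘ there ∘ there ∘ ∈-++⁺ˡ
      d∉Cy = d∉ ∘ there ∘ there ∘ there ∘ ∈-++⁺ʳ Cx

  AbsEq-trans : ∀ {t u v} → AbsEq P t u → AbsEq P u v → AbsEq P t v
  AbsEq-trans h h' =
    let (d , d∉) = fresh (avoided h ++ avoided h')
        (d≢a , _ , d#x , _ , eq) = AbsEq-anyWitness h (d∉ ∘ ∈-++⁺ˡ)
        (_ , d≢e , _ , d#z , eq') = AbsEq-anyWitness h' (d∉ ∘ ∈-++⁺ʳ (avoided h))
    in d , d≢a , d≢e , d#x , d#z , ≈.trans eq eq'

  AbsEq-equivariant : ∀ {a b x y} → AbsEq P (a , x) (b , y) → ∀ π →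
                      AbsEq P (⟦ π ⟧ a , act P π x) (⟦ π ⟧ b , act P π y)
  AbsEq-equivariant {a} {b} {x} {y} (c , c≢a , c≢b , c#x , c#y , eq) π =
    ⟦ π ⟧ c , c≢a ∘ ⟦⟧-injective π , c≢b ∘ ⟦⟧-injective π , Fresh-act c#x π , Fresh-act c#y π ,
    ≈.trans (act-swap-conjugate a x) (≈.trans (act-cong π eq) (≈.sym (act-swap-conjugate b y)))
    where
      act-swap-conjugate : ∀ a x → _≈_ P (act P (swap (⟦ π ⟧ a) (⟦ π ⟧ c)) (act P π x))
                                         (act P π (act P (swap a c) x))
      act-swap-conjugate a x =
        ≈.trans (≈.sym (act-comp (swap (⟦ π ⟧ a) (⟦ π ⟧ c)) π x))
          (≈.trans (act-ext (swap (⟦ π ⟧ a) (⟦ π ⟧ c) ++ π) (π ++ swap a c)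
                     (λ n → sym (trans (⟦⟧-++ π (swap a c) n)
                                       (swapName-conjugate ⟦ π ⟧ (⟦⟧-injective π) a c n))) x)
                   (act-comp π (swap a c) x))

  AbsEq⇒Fresh : ∀ {a b x y} → AbsEq P (a , x) (b , y) → a ≢ b → Fresh P b x
  AbsEq⇒Fresh {a} {b} {x} (c , c≢a , c≢b , c#x , c#y , eq) a≢b =
    Fresh-resp-≈
      (Fresh-swap a c (Fresh-swap b c c#y (swapName-right b c)) (swapName-other (≢-sym a≢b) (≢-sym c≢b)))
      (≈.trans (act-cong (swap a c) (≈.sym eq)) (act-swap-involutive a c x))

  Supports-abs : ∀ {A a y} → Supports P A y → Supports ([𝔸]ₚ P) (a ∷ A) (a , y)
  Supports-abs {a = a} {y} s π fix =
    subst (λ m → AbsEq P (m , act P π y) (a , y)) (sym (fix a (here refl)))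
          (AbsEq-cong (s π (λ n → fix n ∘ there)))

  Supports-resp-AbsEq : ∀ {A t u} → Supports ([𝔸]ₚ P) A t → AbsEq P t u → Supports ([𝔸]ₚ P) A u
  Supports-resp-AbsEq {t = _ , _} {u = _ , _} s h π fix =
    AbsEq-trans (AbsEq-trans (AbsEq-equivariant (AbsEq-sym h) π) (s π fix)) h

  AbsEq-absorbs-≈ : ∀ a x t → (∃ λ y → _≈_ P x y × AbsEq P (a , y) t) → AbsEq P (a , x) t
  AbsEq-absorbs-≈ a x t (y , x≈y , h) = AbsEq-trans (AbsEq-cong x≈y) h

module Kleisli (X Y : NomSet) {R : KRel (pre X) (pre Y)} (kl : IsKlMor (pre X) (pre Y) R) where
  open IsKlMor kl
  private
    module X = Nominal X
    module Y = Nominal Y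

  -- If n ∉ supp x, swapping n with a name e outside supp x and the uniform
  -- support A of R x keeps y in R x; so (n e)·y is supported by A, and y by (n e)·A ∌ n.
  Fresh-preserved : ∀ {x y n} → R x y → Fresh (pre X) n x → Fresh (pre Y) n y
  Fresh-preserved {x} {y} {n} r (B , sB , n∉B) with rel-ufs x
  ... | A , ufs with fresh (n ∷ A ++ B)
  ... | e , e∉ =
    Y.Fresh-resp-≈ (Y.Fresh-swap n e (A , ufs _ swapped∈Rx , e∉ ∘ there ∘ ∈-++⁺ˡ) (swapName-right n e))
                   (Y.act-swap-involutive n e y)
    where
      ne-fixes-B : ∀ b → b ∈ B → swapName n e b ≡ b
      ne-fixes-B b b∈B = swapName-other (∈∧∉⇒≢ b∈B n∉B) (∈∧∉⇒≢ b∈B (e∉ ∘ there ∘ ∈-++⁺ʳ A))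
      swapped∈Rx : R x (act (pre Y) (swap n e) y)
      swapped∈Rx = rel-cong (sB (swap n e) ne-fixes-B) Y.≈.refl (rel-equiv (swap n e) r)

  private
    Fresh-reswap : ∀ {a a' x x' y d} → AbsEq (pre X) (a , x) (a' , x') → R x y →
                   Fresh (pre Y) d y → d ≢ a → d ≢ a' →
                   Fresh (pre Y) d (act (pre Y) (swap a' d) (act (pre Y) (swap a d) y))
    Fresh-reswap {a} {a'} {d = d} h r d#y d≢a d≢a' with a ≟ a'
    ... | yes refl =
      Y.Fresh-swap a d (Y.Fresh-swap a d d#y (swapName-right a d)) (swapName-left a d)
    ... | no a≢a' =
      Y.Fresh-swap a' d
        (Y.Fresh-swap a d (Fresh-preserved r (X.AbsEq⇒Fresh h a≢a'))
                      (swapName-other (≢-sym a≢a') (≢-sym d≢a')))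
        (swapName-left a' d)

  lift-AbsEq : ∀ {a x a' x' y} → AbsEq (pre X) (a , x) (a' , x') → R x y →
               ∃ λ y' → R x' y' × AbsEq (pre Y) (a' , y') (a , y)
  lift-AbsEq {a} {_} {a'} {x'} {y} h r =
    let (By , sy) = Y.finSupp y
        (d , d∉) = fresh (X.avoided h ++ By)
        (d≢a , d≢a' , _ , _ , eq) = X.AbsEq-anyWitness h (d∉ ∘ ∈-++⁺ˡ)
        d#y = By , sy , d∉ ∘ ∈-++⁺ʳ (X.avoided h)
        -- y' ∈ R x' because (a d)·x ≈ (a' d)·x'
        y' = act (pre Y) (swap a' d) (act (pre Y) (swap a d) y)
        y'∈Rx' = rel-cong (X.act-swap-involutive a' d x') Y.≈.refl
                   (rel-equiv (swap a' d) (rel-cong eq Y.≈.refl (rel-equiv (swap a d) r)))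
    in y' , y'∈Rx' , d , d≢a' , d≢a , Fresh-reswap h r d#y d≢a d≢a' , d#y ,
       Y.act-swap-involutive a' d _

Fbar-isKlMor : (P : Poly) (X Y : NomSet) (R : KRel (pre X) (pre Y)) →
               IsKlMor (pre X) (pre Y) R →
               IsKlMor (F P (pre X)) (F P (pre Y)) (Fbar P {pre X} {pre Y} R)
Fbar-isKlMor (const N) X Y R kl = record
  { rel-cong  = λ u≈u' v≈v' u≈v → N.≈.trans (N.≈.sym u≈u') (N.≈.trans u≈v v≈v')
  ; rel-equiv = N.act-cong
  ; rel-ufs   = λ u → let (A , s) = N.finSupp u in A , λ v → N.Supports-resp-≈ s
  }
  where module N = Nominal N
Fbar-isKlMor idF X Y R kl = kl
Fbar-isKlMor absF X Y R kl = record
  { rel-cong  = λ { {_ , _} h t≈t' (y , r , hy) →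
                    let (y' , r' , h') = lift-AbsEq h r in
                    y' , r' , Y.AbsEq-trans (Y.AbsEq-trans h' hy) t≈t' }
  ; rel-equiv = λ { π {_ , _} (y , r , h) → act (pre Y) π y , rel-equiv π r , Y.AbsEq-equivariant h π }
  ; rel-ufs   = λ { (a , x) → let (A , ufs) = rel-ufs x in
                    a ∷ A , λ { t (y , r , h) → Y.Supports-resp-AbsEq (Y.Supports-abs (ufs y r)) h } }
  }
  where
    module Y = Nominal Y
    open IsKlMor kl
    open Kleisli X Y kl
Fbar-isKlMor unitF X Y R kl = record
  { rel-cong = λ _ _ _ → tt ; rel-equiv = λ _ _ → tt ; rel-ufs = λ _ → [] , λ _ _ _ _ → tt }
Fbar-isKlMor (P ⊗ Q) X Y R kl = record
  { rel-cong  = λ { (u≈ , v≈) (u'≈ , v'≈) (r , s) → P.rel-cong u≈ u'≈ r , Q.rel-cong v≈ v'≈ s }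
  ; rel-equiv = λ { π (r , s) → P.rel-equiv π r , Q.rel-equiv π s }
  ; rel-ufs   = λ { (u , v) →
                    let (A , ufsA) = P.rel-ufs u
                        (B , ufsB) = Q.rel-ufs v
                    in A ++ B , λ { (u' , v') (r , s) π fix →
                                      ufsA u' r π (λ n → fix n ∘ ∈-++⁺ˡ) ,
                                      ufsB v' s π (λ n → fix n ∘ ∈-++⁺ʳ A) } }
  }
  where
    module P = IsKlMor (Fbar-isKlMor P X Y R kl)
    module Q = IsKlMor (Fbar-isKlMor Q X Y R kl)
Fbar-isKlMor (∐ I P) X Y R kl = record
  { rel-cong  = λ { {i , _} (mk e) (mk e') (mk r) → mk (Pᵢ.rel-cong i e e' r) }
  ; rel-equiv = λ { π {i , _} (mk r) → mk (Pᵢ.rel-equiv i π r) }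
  ; rel-ufs   = λ { (i , u) → let (A , ufs) = Pᵢ.rel-ufs i u in
                    A , λ { (_ , v) (mk r) π fix → mk (ufs v r π fix) } }
  }
  where
    module Pᵢ i = IsKlMor (Fbar-isKlMor (P i) X Y R kl)

Fbar-resp-id : (P : Poly) (X : NomSet) →
               _≐_ {F P (pre X)} {F P (pre X)} (Fbar P (idK (pre X))) (idK (F P (pre X)))
Fbar-resp-id (const N) X u v = (λ r → r) , (λ r → r)
Fbar-resp-id idF X u v = (λ r → r) , (λ r → r)
Fbar-resp-id absF X (a , x) t = X.AbsEq-absorbs-≈ a x t , λ h → x , X.≈.refl , h
  where module X = Nominal X
Fbar-resp-id unitF X u v = (λ r → r) , (λ r → r)
Fbar-resp-id (P ⊗ Q) X (u , v) (u' , v') =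
  (λ { (r , s) → proj₁ (Fbar-resp-id P X u u') r , proj₁ (Fbar-resp-id Q X v v') s }) ,
  (λ { (r , s) → proj₂ (Fbar-resp-id P X u u') r , proj₂ (Fbar-resp-id Q X v v') s })
Fbar-resp-id (∐ I P) X (i , u) _ =
  (λ { (mk r) → mk (proj₁ (Fbar-resp-id (P i) X u _) r) }) ,
  (λ { (mk r) → mk (proj₂ (Fbar-resp-id (P i) X u _) r) })

Fbar-resp-⊙ : (P : Poly) {X : PreNom} (Y Z : NomSet) (R : KRel X (pre Y)) (S : KRel (pre Y) (pre Z)) →
              IsKlMor (pre Y) (pre Z) S →
              _≐_ {F P X} {F P (pre Z)}
                (Fbar P {X} {pre Z} (_⊙_ {X} {pre Y} {pre Z} S R))
                (_⊙_ {F P X} {F P (pre Y)} {F P (pre Z)}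
                   (Fbar P {pre Y} {pre Z} S) (Fbar P {X} {pre Y} R))
Fbar-resp-⊙ (const N) Y Z R S kS u w =
  (λ r → u , N.≈.refl , r) , (λ { (v , u≈v , v≈w) → N.≈.trans u≈v v≈w })
  where module N = Nominal N
Fbar-resp-⊙ idF Y Z R S kS u w = (λ r → r) , (λ r → r)
Fbar-resp-⊙ absF Y Z R S kS (a , x) t =
  (λ { (z , (y , r , s) , h) → (a , y) , (y , r , Y.AbsEq-refl (a , y)) , (z , s , h) }) ,
  (λ { (_ , (y , r , h) , (z , s , h')) →
        let (z' , s' , h'') = lift-AbsEq (Y.AbsEq-sym h) s
        in z' , (y , r , s') , Z.AbsEq-trans h'' h' })
  where
    module Y = Nominal Y
    module Z = Nominal Z
    open Kleisli Y Z kS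
Fbar-resp-⊙ unitF Y Z R S kS u w = (λ _ → tt , tt , tt) , (λ _ → tt)
Fbar-resp-⊙ (P ⊗ Q) Y Z R S kS (u , v) (u' , v') =
  (λ { (r , s) →
       let (m , r₁ , s₁) = proj₁ (Fbar-resp-⊙ P Y Z R S kS u u') r
           (n , r₂ , s₂) = proj₁ (Fbar-resp-⊙ Q Y Z R S kS v v') s
       in (m , n) , (r₁ , r₂) , (s₁ , s₂) }) ,
  (λ { ((m , n) , (r₁ , r₂) , (s₁ , s₂)) →
       proj₂ (Fbar-resp-⊙ P Y Z R S kS u u') (m , r₁ , s₁) ,
       proj₂ (Fbar-resp-⊙ Q Y Z R S kS v v') (n , r₂ , s₂) })
Fbar-resp-⊙ (∐ I P) Y Z R S kS (i , u) _ =
  (λ { (mk r) → let (m , r' , s') = proj₁ (Fbar-resp-⊙ (P i) Y Z R S kS u _) r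
                in (i , m) , mk r' , mk s' }) ,
  (λ { (_ , mk r , mk s) → mk (proj₂ (Fbar-resp-⊙ (P i) Y Z R S kS u _) (_ , r , s)) })

Fbar-extends : (P : Poly) (Y : NomSet) {X : PreNom} (f : Carrier X → Carrier (pre Y)) →
               _≐_ {F P X} {F P (pre Y)}
                 (Fbar P {X} {pre Y} (J {X} {pre Y} f))
                 (J {F P X} {F P (pre Y)} (Fmap P {X} {pre Y} f))
Fbar-extends (const N) Y f u v = (λ r → r) , (λ r → r)
Fbar-extends idF Y f u v = (λ r → r) , (λ r → r)
Fbar-extends absF Y f (a , x) t = Y.AbsEq-absorbs-≈ a (f x) t , λ h → f x , Y.≈.refl , h
  where module Y = Nominal Y
Fbar-extends unitF Y f u v = (λ r → r) , (λ r → r)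
Fbar-extends (P ⊗ Q) Y f (u , v) (u' , v') =
  (λ { (r , s) → proj₁ (Fbar-extends P Y f u u') r , proj₁ (Fbar-extends Q Y f v v') s }) ,
  (λ { (r , s) → proj₂ (Fbar-extends P Y f u u') r , proj₂ (Fbar-extends Q Y f v v') s })
Fbar-extends (∐ I P) Y f (i , u) _ =
  (λ { (mk r) → mk (proj₁ (Fbar-extends (P i) Y f u _) r) }) ,
  (λ { (mk r) → mk (proj₂ (Fbar-extends (P i) Y f u _) r) })

Fbar-monotone : (P : Poly) {X Y : PreNom} (R S : KRel X Y) →
                _⊑_ {X} {Y} R S → _⊑_ {F P X} {F P Y} (Fbar P {X} {Y} R) (Fbar P {X} {Y} S)
Fbar-monotone (const N) R S R⊑S u v r = r
Fbar-monotone idF R S R⊑S = R⊑S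
Fbar-monotone absF R S R⊑S (a , x) t (y , r , h) = y , R⊑S x y r , h
Fbar-monotone unitF R S R⊑S u v r = r
Fbar-monotone (P ⊗ Q) R S R⊑S (u , v) (u' , v') (r , s) =
  Fbar-monotone P R S R⊑S u u' r , Fbar-monotone Q R S R⊑S v v' s
Fbar-monotone (∐ I P) R S R⊑S (i , u) (_ , v) (mk r) = mk (Fbar-monotone (P i) R S R⊑S u v r)

-- Composition needs only the second morphism to be Kleisli, extension needs no
-- equivariance of f, and monotonicity holds for arbitrary relations.
mainTheorem7 : (P : Poly) → IsLocallyMonotoneExtension P
mainTheorem7 P = record
  { mor      = Fbar-isKlMor P
  ; resp-id  = Fbar-resp-id P
  ; resp-∘   = λ X Y Z R S _ → Fbar-resp-⊙ P Y Z R S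
  ; extends  = λ X Y f _ → Fbar-extends P Y f
  ; monotone = λ X Y R S _ _ → Fbar-monotone P R S
  }
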